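{- Let $k\ge 1$ be a fixed integer. Then there exists an integer $n_0$ such that for every $n\ge n_0$ there exists a graph $G$ on $n$ vertices such that, for every integer $t$ with $1\le t\le k$, $G$ is not a $(k,t)$-threshold-PCG and $G$ is not the complement of a $(k,t)$-threshold-PCG.
   Context: All graphs are finite, simple and undirected. For an edge-weighted tree $T$ (nonnegative real edge weights) and leaves $x,y$, $d_T(x,y)$ is the sum of the weights on the unique $x$–$y$ path; $L(T)$ is the leaf set. A graph $G=(V,E)$ is a PCG if there exist an edge-weighted tree $T$, reals $0\le d_{\min}\le d_{\max}$ and a bijection $\zeta:V\to L(T)$ such that for all distinct $u,v\in V$: $uv\in E \iff d_{\min}\le d_T(\zeta(u),\zeta(v))\le d_{\max}$. For integers $1\le t\le k$, $G=(V,E)$ is a $(k,t)$-threshold-PCG if there exist PCGs $G_1=(V,E_1),\dots,G_k=(V,E_k)$ on the same vertex set such that for all distinct $u,v\in V$: $uv\in E \iff |\{i\in\{1,\dots,k\}: uv\in E_i\}|\ge t$.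
   Formalization: The nonnegative edge weights of the trees and the bounds $d_{\min}$, $d_{\max}$ are taken in ℚ rather than in the reals. -}

module Defs where

open import Data.Nat using (ℕ; zero; suc; _≤_)
open import Data.Bool using (Bool; true; false; not; if_then_else_)
open import Data.Fin using (Fin; _≟_)
open import Data.List using (List; []; _∷_; length; filterᵇ; allFin)
open import Data.List.Relation.Unary.Unique.Propositional using (Unique)
open import Data.Rational using (ℚ; 0ℚ; _+_) renaming (_≤_ to _≤ℚ_)
open import Data.Product using (Σ; ∃; _×_; _,_)
open import Function.Bundles using (_⇔_)
open import Relation.Nullary using (yes; no; does)
open import Relation.Binary.PropositionalEquality using (_≡_; _≢_; refl; sym)

record Graph (n : ℕ) : Set where
  field
    adj    : Fin n → Fin n → Bool
    adjSym : ∀ u v → adj u v ≡ adj v u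
    irrefl : ∀ u → adj u u ≡ false
open Graph public

complementAdj : ∀ {n} → Graph n → Fin n → Fin n → Bool
complementAdj G u v = if does (u ≟ v) then false else not (adj G u v)

private
  complementSym : ∀ {n} (G : Graph n) u v → complementAdj G u v ≡ complementAdj G v u
  complementSym G u v with u ≟ v | v ≟ u
  ... | yes _ | yes _ = refl
  ... | yes refl | no v≢u = Data.Empty.⊥-elim (v≢u refl)
    where import Data.Empty
  ... | no u≢v | yes refl = Data.Empty.⊥-elim (u≢v refl)
    where import Data.Empty
  ... | no _ | no _ rewrite adjSym G u v = refl

  complementIrr : ∀ {n} (G : Graph n) u → complementAdj G u u ≡ false
  complementIrr G u with u ≟ u
  ... | yes _ = refl
  ... | no u≢u = Data.Empty.⊥-elim (u≢u refl)
    where import Data.Empty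

complement : ∀ {n} → Graph n → Graph n
complement G = record
  { adj = complementAdj G ; adjSym = complementSym G ; irrefl = complementIrr G }

data Walk {m : ℕ} (A : Graph m) : Fin m → Fin m → List (Fin m) → Set where
  here : ∀ {x} → Walk A x x (x ∷ [])
  step : ∀ {x z y vs} → adj A x z ≡ true → Walk A z y vs → Walk A x y (x ∷ vs)

IsPath : ∀ {m} → Graph m → Fin m → Fin m → List (Fin m) → Set
IsPath A x y vs = Walk A x y vs × Unique vs

IsTree : ∀ {m} → Graph m → Set
IsTree {m} A = ∀ (x y : Fin m) →
  Σ (List (Fin m)) λ vs → IsPath A x y vs × (∀ ws → IsPath A x y ws → ws ≡ vs)

record WTree (m : ℕ) : Set where
  field
    graph   : Graph m
    isTree  : IsTree graph
    weight  : Fin m → Fin m → ℚ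
    weightSym : ∀ u v → weight u v ≡ weight v u
    weightNonneg : ∀ u v → adj graph u v ≡ true → 0ℚ ≤ℚ weight u v
open WTree public

degree : ∀ {m} → Graph m → Fin m → ℕ
degree {m} A x = length (filterᵇ (adj A x) (allFin m))

IsLeaf : ∀ {m} → Graph m → Fin m → Set
IsLeaf A x = degree A x ≡ 1

listWeight : ∀ {m} → (Fin m → Fin m → ℚ) → List (Fin m) → ℚ
listWeight w [] = 0ℚ
listWeight w (x ∷ []) = 0ℚ
listWeight w (x ∷ y ∷ vs) = w x y + listWeight w (y ∷ vs)

dist : ∀ {m} → WTree m → Fin m → Fin m → ℚ
dist T x y with isTree T x y
... | vs , _ = listWeight (weight T) vs

IsPCG : ∀ {n} → Graph n → Set
IsPCG {n} G =
  Σ ℕ λ m → Σ (WTree m) λ T → Σ ℚ λ dmin → Σ ℚ λ dmax → Σ (Fin n → Fin m) λ ζ →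
    (0ℚ ≤ℚ dmin) × (dmin ≤ℚ dmax)
    × (∀ u v → ζ u ≡ ζ v → u ≡ v)
    × (∀ u → IsLeaf (graph T) (ζ u))
    × (∀ x → IsLeaf (graph T) x → ∃ λ u → ζ u ≡ x)
    × (∀ u v → u ≢ v →
         (adj G u v ≡ true) ⇔ ((dmin ≤ℚ dist T (ζ u) (ζ v)) × (dist T (ζ u) (ζ v) ≤ℚ dmax)))

countAdj : ∀ {k n} → (Fin k → Graph n) → Fin n → Fin n → ℕ
countAdj {k} Gs u v = length (filterᵇ (λ i → adj (Gs i) u v) (allFin k))

IsThresholdPCG : (k t : ℕ) → ∀ {n} → Graph n → Set
IsThresholdPCG k t {n} G =
  Σ (Fin k → Graph n) λ Gs →
    (∀ i → IsPCG (Gs i))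
    × (∀ u v → u ≢ v → (adj G u v ≡ true) ⇔ (t ≤ countAdj Gs u v))

-- Root the tree of a PCG at the leaf of one vertex of a set σ of s + 1 vertices, and let depth x
-- and meet a b be the depths of the leaf x and of the branch point of the leaves a and b. Then
-- d(a, b) = depth a + depth b - 2 meet a b, and meet is ultrametric: meet a y ⊓ meet y x ≤ meet a x.
-- Given the leaf a of a vertex outside σ, let y ∈ σ maximise β = meet a y; then
-- meet a x = β ⊓ meet y x for all x ∈ σ. So the neighbours of a in σ are determined by y, by the set
-- of x with meet y x ≤ β, and by the sets of x for which depth x - 2 meet y x, respectively depth x,
-- lies in an interval. A set {x | f x ≤ θ} is empty or equals {x | f x ≤ f z} for some z ∈ σ, so
-- vertices outside σ have at most (s + 2)^6 distinct neighbourhoods in σ, and in a (k,t)-threshold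
-- PCG, where they are determined by the neighbourhoods in k PCGs, at most (s + 2)^(6k). But in the
-- graph in which 2^(s+1) further vertices see every subset of σ all 2^(s+1) subsets occur, and so
-- they do in its complement; it remains to pick s with (s + 2)^(6k) < 2^(s+1).
module Submission where

open import Defs
open import Data.Bool using (Bool; true; false; not; _∧_; if_then_else_)
open import Data.Bool.Properties using (T-≡; not-involutive)
open import Data.Empty using (⊥; ⊥-elim)
open import Data.Fin as Fin using (Fin; funToFin; finToFun)
open import Data.Fin.Properties
  using ( 2↔Bool; *↔×; finToFun-funToFin; funToFin-finToFin; pigeonhole; splitAt-↑ˡ; splitAt-↑ʳ
        ; toℕ-injective; toℕ-fromℕ<; toℕ-inject≤; toℕ<n; inject≤-injective )
open import Data.List using (List; []; _∷_; _++_; _∷ʳ_; take; reverse; length; filter; filterᵇ; allFin)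
open import Data.List.Properties
  using (++-assoc; ++-cancelˡ; ++-conicalʳ; ∷-injective; ∷-injectiveʳ; ∷ʳ-injective; unfold-reverse)
open import Data.List.Membership.Propositional using (_∈_)
open import Data.List.Membership.Propositional.Properties using (∈-∃++; ∈-filter⁺; ∈-filter⁻; ∈-allFin)
import Data.List.Relation.Unary.All as All
import Data.List.Relation.Unary.All.Properties as All
open import Data.List.Relation.Unary.Any using (here; there)
import Data.List.Relation.Unary.Any.Properties as Any
open import Data.List.Relation.Unary.Unique.Propositional using (Unique; []; _∷_)
import Data.List.Relation.Unary.Unique.Propositional.Properties as Unique
open import Data.List.Relation.Binary.Disjoint.Propositional using (Disjoint)
open import Data.List.Relation.Binary.Permutation.Propositional using (↭⇒↭ₛ; ↭-sym)
open import Data.List.Relation.Binary.Permutation.Propositional.Properties using (↭-reverse)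
import Data.List.Relation.Binary.Permutation.Setoid.Properties as Permutation
open import Data.Maybe using (Maybe; just; nothing)
open import Data.Nat as ℕ using (ℕ; zero; suc; _≤_; _<_; _^_; _⊓_; z≤n; s≤s; _≤′_; ≤′-refl; ≤′-step)
import Data.Nat.Properties as ℕ
open import Data.Nat.Solver using () renaming (module +-*-Solver to ℕ-Solver)
open import Data.Product using (Σ; ∃; ∃₂; _×_; _,_; proj₁; proj₂)
open import Data.Product.Function.NonDependent.Propositional using (_×-↔_)
open import Data.Rational as ℚ using (ℚ; 0ℚ; _+_; _-_) renaming (_≤_ to _≤ℚ_)
import Data.Rational.Properties as ℚ
open import Data.Rational.Solver using (module +-*-Solver)
open import Data.Sum using (_⊎_; inj₁; inj₂)
open import Function using (_∘_; case_of_)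
open import Function.Bundles using (_⇔_; mk⇔; Equivalence; _↔_; Inverse)
import Function.Properties.Equivalence as ⇔
open import Function.Properties.Inverse using (↔-refl; ↔-trans)
open import Relation.Binary.Bundles using (DecTotalOrder)
import Relation.Binary.Construct.Flip.EqAndOrd as Flip
open import Relation.Binary.Definitions using (DecidableEquality)
open import Relation.Binary.PropositionalEquality
open import Relation.Nullary using (Dec; yes; no; ¬_; does; _×-dec_)
open import Relation.Nullary.Decidable using (dec-false; does-⇔; T?)

module _ {A : Set} where

  Unique-++⁻ˡ : ∀ xs {ys : List A} → Unique (xs ++ ys) → Unique xs
  Unique-++⁻ˡ []       u        = []
  Unique-++⁻ˡ (x ∷ xs) (x∉ ∷ u) = All.++⁻ˡ xs x∉ ∷ Unique-++⁻ˡ xs u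

  Unique-++⁻ʳ : ∀ xs {ys : List A} → Unique (xs ++ ys) → Unique ys
  Unique-++⁻ʳ []       u       = u
  Unique-++⁻ʳ (x ∷ xs) (_ ∷ u) = Unique-++⁻ʳ xs u

  Unique-reverse : ∀ (xs : List A) → Unique xs → Unique (reverse xs)
  Unique-reverse xs = Permutation.Unique-resp-↭ (setoid A) (↭⇒↭ₛ (↭-sym (↭-reverse xs)))

module CommonPrefix {A : Set} (_≟_ : DecidableEquality A) where

  commonPrefixLength : List A → List A → ℕ
  commonPrefixLength []       _        = 0
  commonPrefixLength (_ ∷ _)  []       = 0
  commonPrefixLength (x ∷ xs) (y ∷ ys) with x ≟ y
  ... | yes _ = suc (commonPrefixLength xs ys)
  ... | no  _ = 0

  commonPrefixLength-∷ : ∀ x xs ys →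
                         commonPrefixLength (x ∷ xs) (x ∷ ys) ≡ suc (commonPrefixLength xs ys)
  commonPrefixLength-∷ x xs ys with x ≟ x
  ... | yes _  = refl
  ... | no x≢x = ⊥-elim (x≢x refl)

  commonPrefixLength-comm : ∀ xs ys → commonPrefixLength xs ys ≡ commonPrefixLength ys xs
  commonPrefixLength-comm []       []       = refl
  commonPrefixLength-comm []       (_ ∷ _)  = refl
  commonPrefixLength-comm (_ ∷ _)  []       = refl
  commonPrefixLength-comm (x ∷ xs) (y ∷ ys) with x ≟ y | y ≟ x
  ... | yes _   | yes _   = cong suc (commonPrefixLength-comm xs ys)
  ... | yes x≡y | no  y≢x = ⊥-elim (y≢x (sym x≡y))
  ... | no  x≢y | yes y≡x = ⊥-elim (x≢y (sym y≡x))
  ... | no  _   | no  _   = refl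

  take-commonPrefix : ∀ xs ys {q} → q ≤ commonPrefixLength xs ys → take q xs ≡ take q ys
  take-commonPrefix xs       ys       {zero}  _ = refl
  take-commonPrefix []       _        {suc q} ()
  take-commonPrefix (_ ∷ _)  []       {suc q} ()
  take-commonPrefix (x ∷ xs) (y ∷ ys) {suc q} q≤ with x ≟ y
  take-commonPrefix (x ∷ xs) (y ∷ ys) {suc q} (s≤s q≤) | yes refl = cong (x ∷_) (take-commonPrefix xs ys q≤)
  take-commonPrefix (x ∷ xs) (y ∷ ys) {suc q} ()       | no _

  commonPrefixLength-ultrametric : ∀ xs ys zs →
    commonPrefixLength xs ys ⊓ commonPrefixLength ys zs ≤ commonPrefixLength xs zs
  commonPrefixLength-ultrametric []       _        _        = z≤n
  commonPrefixLength-ultrametric (_ ∷ _)  []       _        = z≤n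
  commonPrefixLength-ultrametric (x ∷ xs) (y ∷ ys) []       = ℕ.≤-reflexive (ℕ.⊓-zeroʳ _)
  commonPrefixLength-ultrametric (x ∷ xs) (y ∷ ys) (z ∷ zs) with x ≟ y | y ≟ z | x ≟ z
  ... | yes _    | yes _    | yes _  = s≤s (commonPrefixLength-ultrametric xs ys zs)
  ... | yes refl | yes refl | no x≢z = ⊥-elim (x≢z refl)
  ... | yes _    | no _     | _      = z≤n
  ... | no _     | _        | _      = z≤n

  Diverge : List A → List A → Set
  Diverge xs ys = ∀ {z us vs} → xs ≡ z ∷ us → ys ≡ z ∷ vs → ⊥

  Diverge-++ : ∀ L {z us vs} → ¬ Diverge (L ++ z ∷ us) (L ++ z ∷ vs)
  Diverge-++ []      d = d refl refl
  Diverge-++ (_ ∷ _) d = d refl refl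

  split-at-divergence : ∀ x xs ys → ∃₂ λ C w → ∃₂ λ us vs →
    x ∷ xs ≡ C ++ w ∷ us × x ∷ ys ≡ C ++ w ∷ vs ×
    x ∷ take (commonPrefixLength xs ys) xs ≡ C ++ w ∷ [] × Diverge us vs
  split-at-divergence x []       ys       = [] , x , [] , ys , refl , refl , refl , λ ()
  split-at-divergence x (p ∷ xs) []       = [] , x , p ∷ xs , [] , refl , refl , refl , λ _ ()
  split-at-divergence x (p ∷ xs) (q ∷ ys) with p ≟ q
  ... | yes refl =
    let C , w , us , vs , e₁ , e₂ , e₃ , d = split-at-divergence p xs ys
    in x ∷ C , w , us , vs , cong (x ∷_) e₁ , cong (x ∷_) e₂ , cong (x ∷_) e₃ , d
  ... | no p≢q = [] , x , p ∷ xs , q ∷ ys , refl , refl , refl , λ { refl refl → p≢q refl }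

-- Walks and their weights

module _ {m} (A : Graph m) where

  walk-head : ∀ {x y L} → Walk A x y L → ∃ λ vs → L ≡ x ∷ vs
  walk-head here       = _ , refl
  walk-head (step _ _) = _ , refl

  walk-++ : ∀ {x w y L M} → Walk A x w L → Walk A w y (w ∷ M) → Walk A x y (L ++ M)
  walk-++ here       q = q
  walk-++ (step e p) q = step e (walk-++ p q)

  walk-reverse : ∀ {x y L} → Walk A x y L → Walk A y x (reverse L)
  walk-reverse here = here
  walk-reverse {x} (step {z = z} {vs = vs} e p) rewrite unfold-reverse x vs =
    walk-++ (walk-reverse p) (step (trans (adjSym A z x) e) here)

  walk-split : ∀ L {x y z M K} → Walk A x y K → K ≡ L ++ z ∷ M →
               Walk A x z (L ++ z ∷ []) × Walk A z y (z ∷ M)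
  walk-split []      here       refl = here , here
  walk-split []      (step e p) refl = here , step e p
  walk-split (_ ∷ L) {z = z} {M} here eq with () ← ++-conicalʳ L (z ∷ M) (sym (∷-injectiveʳ eq))
  walk-split (_ ∷ L) (step e p) eq with refl ← proj₁ (∷-injective eq) =
    let p₁ , p₂ = walk-split L p (∷-injectiveʳ eq) in step e p₁ , p₂

module _ {m} (w : Fin m → Fin m → ℚ) where

  private
    len = listWeight w

  listWeight-++ : ∀ L z M → len (L ++ z ∷ M) ≡ len (L ++ z ∷ []) + len (z ∷ M)
  listWeight-++ []          z M = sym (ℚ.+-identityˡ _)
  listWeight-++ (x ∷ [])    z M = cong (_+ len (z ∷ M)) (sym (ℚ.+-identityʳ (w x z)))
  listWeight-++ (x ∷ y ∷ L) z M = begin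
    w x y + len (y ∷ L ++ z ∷ M)                  ≡⟨ cong (w x y +_) (listWeight-++ (y ∷ L) z M) ⟩
    w x y + (len (y ∷ L ++ z ∷ []) + len (z ∷ M)) ≡⟨ ℚ.+-assoc (w x y) _ _ ⟨
    w x y + len (y ∷ L ++ z ∷ []) + len (z ∷ M)   ∎
    where open ≡-Reasoning

  listWeight-reverse : (∀ x y → w x y ≡ w y x) → ∀ L → len (reverse L) ≡ len L
  listWeight-reverse w-sym []          = refl
  listWeight-reverse w-sym (x ∷ [])    = refl
  listWeight-reverse w-sym (x ∷ y ∷ L) = begin
    len (reverse (x ∷ y ∷ L))                ≡⟨ cong len reverse-xyL ⟩
    len (reverse L ++ y ∷ x ∷ [])            ≡⟨ listWeight-++ (reverse L) y (x ∷ []) ⟩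
    len (reverse L ++ y ∷ []) + (w y x + 0ℚ) ≡⟨ cong (λ L′ → len L′ + (w y x + 0ℚ)) (unfold-reverse y L) ⟨
    len (reverse (y ∷ L)) + (w y x + 0ℚ)     ≡⟨ cong₂ _+_ (listWeight-reverse w-sym (y ∷ L))
                                                          (trans (ℚ.+-identityʳ _) (w-sym y x)) ⟩
    len (y ∷ L) + w x y                      ≡⟨ ℚ.+-comm _ (w x y) ⟩
    len (x ∷ y ∷ L)                          ∎
    where
    open ≡-Reasoning
    reverse-xyL : reverse (x ∷ y ∷ L) ≡ reverse L ++ y ∷ x ∷ []
    reverse-xyL = begin
      reverse (x ∷ y ∷ L)     ≡⟨ unfold-reverse x (y ∷ L) ⟩
      reverse (y ∷ L) ∷ʳ x    ≡⟨ cong (_∷ʳ x) (unfold-reverse y L) ⟩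
      reverse L ∷ʳ y ∷ʳ x     ≡⟨ ++-assoc (reverse L) (y ∷ []) (x ∷ []) ⟩
      reverse L ++ y ∷ x ∷ [] ∎

-- Rooted weighted trees

module _ {A : Set} (g : A → A → ℚ) (g-comm : ∀ a b → g a b ≡ g b a)
         (g-ultrametric : ∀ a b c → g a b ℚ.⊓ g b c ≤ℚ g a c) where

  ultrametric-pivot : ∀ {a y x} → g a x ≤ℚ g a y → g a x ≡ g a y ℚ.⊓ g y x
  ultrametric-pivot {a} {y} {x} gax≤gay = ℚ.≤-antisym (ℚ.⊓-glb gax≤gay gax≤gyx) (g-ultrametric a y x)
    where
    gax≤gyx : g a x ≤ℚ g y x
    gax≤gyx = subst (_≤ℚ g y x) (ℚ.p≥q⇒p⊓q≡q (subst (g a x ≤ℚ_) (g-comm a y) gax≤gay))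
                    (g-ultrametric y a x)

module RootedTree {m} (T : WTree m) (r : Fin m) where

  open CommonPrefix (Fin._≟_ {m})

  private
    len = listWeight (weight T)

  rootPath : Fin m → List (Fin m)
  rootPath x = proj₁ (isTree T r x)

  rootPath-isPath : ∀ x → IsPath (graph T) r x (rootPath x)
  rootPath-isPath x = proj₁ (proj₂ (isTree T r x))

  rootPath-unique : ∀ {x} vs → IsPath (graph T) r x vs → vs ≡ rootPath x
  rootPath-unique {x} = proj₂ (proj₂ (isTree T r x))

  rootPath-prefix : ∀ {y} L {z} M → rootPath y ≡ L ++ z ∷ M → L ++ z ∷ [] ≡ rootPath z
  rootPath-prefix {y} L {z} M eq = rootPath-unique _ (prefix-walk , prefix-unique)
    where
    prefix-walk = proj₁ (walk-split (graph T) L (proj₁ (rootPath-isPath y)) eq)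
    prefix-unique = Unique-++⁻ˡ (L ++ z ∷ [])
      (subst Unique (trans eq (sym (++-assoc L (z ∷ []) M))) (proj₂ (rootPath-isPath y)))

  depth : Fin m → ℚ
  depth x = len (rootPath x)

  meet : Fin m → Fin m → ℚ
  meet a b = len (take (commonPrefixLength (rootPath a) (rootPath b)) (rootPath a))

  branch-point : ∀ a b → ∃₂ λ C w → ∃₂ λ us vs →
    rootPath a ≡ C ++ w ∷ us × rootPath b ≡ C ++ w ∷ vs × meet a b ≡ len (C ++ w ∷ []) × Diverge us vs
  branch-point a b
    with as , ea ← walk-head (graph T) (proj₁ (rootPath-isPath a))
       | bs , eb ← walk-head (graph T) (proj₁ (rootPath-isPath b))
    with C , w , us , vs , e₁ , e₂ , e₃ , d ← split-at-divergence r as bs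
    = C , w , us , vs , trans ea e₁ , trans eb e₂ , meet≡ , d
    where
    open ≡-Reasoning
    meet≡ : meet a b ≡ len (C ++ w ∷ [])
    meet≡ = begin
      meet a b
        ≡⟨ cong₂ (λ P Q → len (take (commonPrefixLength P Q) P)) ea eb ⟩
      len (take (commonPrefixLength (r ∷ as) (r ∷ bs)) (r ∷ as))
        ≡⟨ cong (λ k → len (take k (r ∷ as))) (commonPrefixLength-∷ r as bs) ⟩
      len (r ∷ take (commonPrefixLength as bs) as)
        ≡⟨ cong len e₃ ⟩
      len (C ++ w ∷ []) ∎

  branches-disjoint : ∀ {a b} C w {us vs} → rootPath a ≡ C ++ w ∷ us → rootPath b ≡ C ++ w ∷ vs →
                      Diverge us vs → Disjoint us vs
  branches-disjoint C w ea eb d (z∈us , z∈vs)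
    with us₁ , us₂ , refl ← ∈-∃++ z∈us | vs₁ , vs₂ , refl ← ∈-∃++ z∈vs
    = Diverge-++ vs₁ (subst (λ L → Diverge (L ++ _ ∷ us₂) (vs₁ ++ _ ∷ vs₂)) same-prefix d)
    where
    same-prefix : us₁ ≡ vs₁
    same-prefix = ∷-injectiveʳ (++-cancelˡ C _ _ (proj₁ (∷ʳ-injective _ _ (trans
      (rootPath-prefix (C ++ w ∷ us₁) us₂ (trans ea (sym (++-assoc C (w ∷ us₁) _))))
      (sym (rootPath-prefix (C ++ w ∷ vs₁) vs₂ (trans eb (sym (++-assoc C (w ∷ vs₁) _)))))))))

  dist-path : ∀ {a b} vs → IsPath (graph T) a b vs → dist T a b ≡ len vs
  dist-path {a} {b} vs p with isTree T a b
  ... | _ , _ , unique = cong len (sym (unique vs p))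

  dist-branches : ∀ {a b} C w {us vs} → rootPath a ≡ C ++ w ∷ us → rootPath b ≡ C ++ w ∷ vs →
                  Diverge us vs → dist T a b ≡ len (w ∷ us) + len (w ∷ vs)
  dist-branches {a} {b} C w {us} {vs} ea eb d = begin
    dist T a b                                ≡⟨ dist-path _ (path-ab , unique-ab) ⟩
    len (reverse (w ∷ us) ++ vs)              ≡⟨ cong len (trans (cong (_++ vs) (unfold-reverse w us))
                                                                 (++-assoc (reverse us) (w ∷ []) vs)) ⟩
    len (reverse us ++ w ∷ vs)                ≡⟨ listWeight-++ (weight T) (reverse us) w vs ⟩
    len (reverse us ++ w ∷ []) + len (w ∷ vs) ≡⟨ cong (λ L → len L + len (w ∷ vs)) (unfold-reverse w us) ⟨
    len (reverse (w ∷ us)) + len (w ∷ vs)     ≡⟨ cong (_+ len (w ∷ vs))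
                                                      (listWeight-reverse (weight T) (weightSym T) (w ∷ us)) ⟩
    len (w ∷ us) + len (w ∷ vs)               ∎
    where
    open ≡-Reasoning
    branch : ∀ {x} vs → rootPath x ≡ C ++ w ∷ vs → IsPath (graph T) w x (w ∷ vs)
    branch {x} _ ex = proj₂ (walk-split (graph T) C (proj₁ (rootPath-isPath x)) ex)
                    , Unique-++⁻ʳ C (subst Unique ex (proj₂ (rootPath-isPath x)))
    branch-a = branch us ea
    branch-b = branch vs eb
    path-ab : Walk (graph T) a b (reverse (w ∷ us) ++ vs)
    path-ab = walk-++ (graph T) (walk-reverse (graph T) (proj₁ branch-a)) (proj₁ branch-b)
    disjoint : Disjoint (reverse (w ∷ us)) vs
    disjoint (v∈ , v∈vs) with Any.reverse⁻ {xs = w ∷ us} v∈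
    ... | here refl  = Unique.Unique[x∷xs]⇒x∉xs (proj₂ branch-b) v∈vs
    ... | there v∈us = branches-disjoint C w ea eb d (v∈us , v∈vs)
    unique-ab : Unique (reverse (w ∷ us) ++ vs)
    unique-ab = Unique.++⁺ (Unique-reverse _ (proj₂ branch-a)) (Unique-++⁻ʳ (w ∷ []) (proj₂ branch-b)) disjoint

  dist+meet : ∀ a b → dist T a b + (meet a b + meet a b) ≡ depth a + depth b
  dist+meet a b with C , w , us , vs , ea , eb , em , d ← branch-point a b = begin
    dist T a b + (meet a b + meet a b) ≡⟨ cong₂ (λ D μ → D + (μ + μ)) (dist-branches C w ea eb d) em ⟩
    (U + V) + (M + M)                  ≡⟨ solve 3 (λ u v μ → (u :+ v) :+ (μ :+ μ) := (μ :+ u) :+ (μ :+ v))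
                                                  refl U V M ⟩
    (M + U) + (M + V)                  ≡⟨ cong₂ _+_ (depth≡ ea) (depth≡ eb) ⟨
    depth a + depth b                  ∎
    where
    open ≡-Reasoning
    open +-*-Solver
    M = len (C ++ w ∷ [])
    U = len (w ∷ us)
    V = len (w ∷ vs)
    depth≡ : ∀ {x zs} → rootPath x ≡ C ++ w ∷ zs → depth x ≡ M + len (w ∷ zs)
    depth≡ {zs = zs} ex = trans (cong len ex) (listWeight-++ (weight T) C w zs)

  dist-via-meet : ∀ a b → dist T a b ≡ depth a + depth b - (meet a b + meet a b)
  dist-via-meet a b = begin
    dist T a b                  ≡⟨ solve 2 (λ D e → D := D :+ e :- e) refl (dist T a b) e ⟩
    dist T a b + e - e          ≡⟨ cong (_- e) (dist+meet a b) ⟩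
    depth a + depth b - e       ∎
    where
    open ≡-Reasoning
    open +-*-Solver
    e = meet a b + meet a b

  meet-comm : ∀ a b → meet a b ≡ meet b a
  meet-comm a b = cong len (begin
    take (commonPrefixLength Pa Pb) Pa ≡⟨ take-commonPrefix Pa Pb ℕ.≤-refl ⟩
    take (commonPrefixLength Pa Pb) Pb ≡⟨ cong (λ k → take k Pb) (commonPrefixLength-comm Pa Pb) ⟩
    take (commonPrefixLength Pb Pa) Pb ∎)
    where
    open ≡-Reasoning
    Pa = rootPath a
    Pb = rootPath b

  len-take-suc : ∀ {x y L} → Walk (graph T) x y L → ∀ ℓ → len (take ℓ L) ≤ℚ len (take (suc ℓ) L)
  len-take-suc here       zero          = ℚ.≤-refl
  len-take-suc here       (suc zero)    = ℚ.≤-refl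
  len-take-suc here       (suc (suc _)) = ℚ.≤-refl
  len-take-suc (step _ _) zero          = ℚ.≤-refl
  len-take-suc {x} (step {z = z} e p) (suc zero) with _ , refl ← walk-head (graph T) p =
    ℚ.≤-trans (weightNonneg T x z e) (ℚ.≤-reflexive (sym (ℚ.+-identityʳ _)))
  len-take-suc {x} (step {z = z} e p) (suc (suc ℓ)) with _ , refl ← walk-head (graph T) p =
    ℚ.+-monoʳ-≤ (weight T x z) (len-take-suc p (suc ℓ))

  len-take-mono : ∀ {x y L ℓ ℓ′} → Walk (graph T) x y L → ℓ ≤ ℓ′ → len (take ℓ L) ≤ℚ len (take ℓ′ L)
  len-take-mono {L = L} {ℓ} p ℓ≤ℓ′ = go (ℕ.≤⇒≤′ ℓ≤ℓ′)
    where
    go : ∀ {ℓ′} → ℓ ≤′ ℓ′ → len (take ℓ L) ≤ℚ len (take ℓ′ L)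
    go ≤′-refl     = ℚ.≤-refl
    go (≤′-step q) = ℚ.≤-trans (go q) (len-take-suc p _)

  meet-ultrametric : ∀ a b c → meet a b ℚ.⊓ meet b c ≤ℚ meet a c
  meet-ultrametric a b c = ℚ.≤-trans meet-min
    (len-take-mono (proj₁ (rootPath-isPath a)) (commonPrefixLength-ultrametric Pa Pb Pc))
    where
    open ≡-Reasoning
    Pa = rootPath a
    Pb = rootPath b
    Pc = rootPath c
    p = commonPrefixLength Pa Pb
    q = commonPrefixLength Pb Pc
    meet-min : meet a b ℚ.⊓ meet b c ≤ℚ len (take (p ⊓ q) Pa)
    meet-min with ℕ.≤-total p q
    ... | inj₁ p≤q = ℚ.≤-trans (ℚ.p⊓q≤p _ _)
      (ℚ.≤-reflexive (cong (λ k → len (take k Pa)) (sym (ℕ.m≤n⇒m⊓n≡m p≤q))))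
    ... | inj₂ q≤p = ℚ.≤-trans (ℚ.p⊓q≤q (meet a b) _) (ℚ.≤-reflexive (begin
      len (take q Pb)       ≡⟨ cong len (take-commonPrefix Pa Pb q≤p) ⟨
      len (take q Pa)       ≡⟨ cong (λ k → len (take k Pa)) (ℕ.m≥n⇒m⊓n≡n q≤p) ⟨
      len (take (p ⊓ q) Pa) ∎))

  meet-pivot : ∀ {N} (ℓ : Fin (suc N) → Fin m) a →
               ∃ λ y → ∀ x → meet a (ℓ x) ≡ meet a (ℓ y) ℚ.⊓ meet (ℓ y) (ℓ x)
  meet-pivot {N} ℓ a = y , λ x → ultrametric-pivot meet meet-comm meet-ultrametric
    (All.lookup (f[xs]≤f[argmax] {f = λ y → meet a (ℓ y)} Fin.zero (allFin (suc N))) (∈-allFin x))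
    where
    open import Data.List.Extrema (DecTotalOrder.totalOrder ℚ.≤-decTotalOrder) using (argmax; f[xs]≤f[argmax])
    y = argmax (λ y → meet a (ℓ y)) Fin.zero (allFin (suc N))

-- Cuts and intervals of finite families

module Cut {b ℓ₁ ℓ₂} (O : DecTotalOrder b ℓ₁ ℓ₂) where

  open DecTotalOrder O using (totalOrder)
    renaming (Carrier to B; _≤_ to _≼_; _≤?_ to _≼?_; trans to ≼-trans)
  open import Data.List.Extrema totalOrder using (argmax; argmax-all; f[⊥]≤f[argmax]; f[xs]≤f[argmax])

  lowerCut : ∀ {N} → (Fin N → B) → Fin (suc N) → Fin N → Bool
  lowerCut f Fin.zero    x = false
  lowerCut f (Fin.suc z) x = does (f x ≼? f z)

  lowerCut-complete : ∀ {N} (f : Fin N → B) θ → ∃ λ c → ∀ x → lowerCut f c x ≡ does (f x ≼? θ)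
  lowerCut-complete {N} f θ = from-members (filter (λ x → f x ≼? θ) (allFin N)) λ x →
    mk⇔ (λ x∈ → proj₂ (∈-filter⁻ (λ x → f x ≼? θ) {xs = allFin N} x∈))
        (∈-filter⁺ (λ x → f x ≼? θ) (∈-allFin x))
    where
    from-members : ∀ zs → (∀ x → x ∈ zs ⇔ f x ≼ θ) → ∃ λ c → ∀ x → lowerCut f c x ≡ does (f x ≼? θ)
    from-members []       mem = Fin.zero , λ x →
      sym (dec-false (f x ≼? θ) λ fx≼θ → case Equivalence.from (mem x) fx≼θ of λ ())
    from-members (z ∷ zs) mem = Fin.suc μ , λ x →
      does-⇔ (mk⇔ (λ fx≼fμ → ≼-trans fx≼fμ fμ≼θ) (below-μ x)) (f x ≼? f μ) (f x ≼? θ)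
      where
      μ = argmax f z zs
      fμ≼θ : f μ ≼ θ
      fμ≼θ = argmax-all f (Equivalence.to (mem z) (here refl))
                          (All.tabulate λ z∈ → Equivalence.to (mem _) (there z∈))
      below-μ : ∀ x → f x ≼ θ → f x ≼ f μ
      below-μ x fx≼θ with Equivalence.from (mem x) fx≼θ
      ... | here refl = f[⊥]≤f[argmax] {f = f} z zs
      ... | there x∈  = All.lookup (f[xs]≤f[argmax] {f = f} z zs) x∈

open Cut ℚ.≤-decTotalOrder using (lowerCut; lowerCut-complete)
open Cut (Flip.decTotalOrder ℚ.≤-decTotalOrder) using ()
  renaming (lowerCut to upperCut; lowerCut-complete to upperCut-complete)

InRange : ℚ → ℚ → ℚ → Set
InRange lo hi p = lo ≤ℚ p × p ≤ℚ hi

inRange? : ∀ lo hi p → Dec (InRange lo hi p)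
inRange? lo hi p = lo ℚ.≤? p ×-dec p ℚ.≤? hi

InRange-+ : ∀ c {lo hi p} → InRange lo hi (p + c) ⇔ InRange (lo - c) (hi - c) p
InRange-+ c {lo} {hi} {p} = mk⇔
  (λ (l , u) → +-cancelʳ-≤ (subst (_≤ℚ p + c) (sym (-+ lo)) l) , +-cancelʳ-≤ (subst (p + c ≤ℚ_) (sym (-+ hi)) u))
  (λ (l , u) → subst (_≤ℚ p + c) (-+ lo) (ℚ.+-monoˡ-≤ c l) , subst (p + c ≤ℚ_) (-+ hi) (ℚ.+-monoˡ-≤ c u))
  where
  open +-*-Solver
  -+ : ∀ a → a - c + c ≡ a
  -+ a = solve 2 (λ a c → a :- c :+ c := a) refl a c
  +- : ∀ a → a + c - c ≡ a
  +- a = solve 2 (λ a c → a :+ c :- c := a) refl a c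
  +-cancelʳ-≤ : ∀ {q r} → q + c ≤ℚ r + c → q ≤ℚ r
  +-cancelʳ-≤ {q} {r} le = subst₂ _≤ℚ_ (+- q) (+- r) (ℚ.+-monoˡ-≤ (ℚ.- c) le)

Interval : ℕ → Set
Interval N = Fin (suc N) × Fin (suc N)

within : ∀ {N} → (Fin N → ℚ) → Interval N → Fin N → Bool
within f (l , u) x = upperCut f l x ∧ lowerCut f u x

within-complete : ∀ {N} (f : Fin N → ℚ) lo hi → ∃ λ i → ∀ x → within f i x ≡ does (inRange? lo hi (f x))
within-complete f lo hi with l , hl ← upperCut-complete f lo | u , hu ← lowerCut-complete f hi =
  (l , u) , λ x → cong₂ _∧_ (hl x) (hu x)

-- Traces of PCGs and threshold PCGs

≡-does : ∀ {b} {P : Set} → (b ≡ true ⇔ P) → (P? : Dec P) → b ≡ does P?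
≡-does {b} b⇔P P? = does-⇔ (⇔.trans T-≡ b⇔P) (T? b) P?

if-does : ∀ {P A : Set} (P? : Dec P) {r t e : A} → (P → r ≡ t) → (¬ P → r ≡ e) →
          r ≡ (if does P? then t else e)
if-does (yes p) r≡t _   = r≡t p
if-does (no ¬p) _   r≡e = r≡e ¬p

Outside : ∀ {n N} → (Fin N → Fin n) → Fin n → Set
Outside σ v = ∀ x → v ≢ σ x

TracesAmong : ∀ {n N} → Set → Graph n → (Fin N → Fin n) → Set
TracesAmong {N = N} A G σ = Σ (A → Fin N → Bool) λ decode →
  ∀ v → Outside σ v → ∃ λ a → ∀ x → adj G v (σ x) ≡ decode a x

TracesAmong-↔ : ∀ {n N A B} {G : Graph n} {σ : Fin N → Fin n} →
                B ↔ A → TracesAmong A G σ → TracesAmong B G σ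
TracesAmong-↔ B↔A (decode , coded) = decode ∘ Inverse.to B↔A , λ v v∉ →
  let a , v≡a = coded v v∉
  in Inverse.from B↔A a , λ x → trans (v≡a x) (cong (λ a → decode a x) (sym (Inverse.strictlyInverseˡ B↔A a)))

-- All arguments are explicit: inferring p or q from a goal mentioning does (inRange? …) makes Agda
-- unfold the decision procedure of ℚ's ≤ and exhaust memory.
inRange?-+ : ∀ lo hi p q c → p ≡ q + c → does (inRange? lo hi p) ≡ does (inRange? (lo - c) (hi - c) q)
inRange?-+ lo hi _ q c refl = does-⇔ (InRange-+ c) (inRange? lo hi (q + c)) (inRange? (lo - c) (hi - c) q)

PCGCode : ℕ → Set
PCGCode s = Fin (suc s) × Fin (suc (suc s)) × Interval (suc s) × Interval (suc s)

module _ {s} (H : Fin (suc s) → ℚ) (M : Fin (suc s) → Fin (suc s) → ℚ) where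

  private
    F : Fin (suc s) → Fin (suc s) → ℚ
    F y x = H x - (M y x + M y x)

  decodeTrace : PCGCode s → Fin (suc s) → Bool
  decodeTrace (y , c , i , j) x = if lowerCut (M y) c x then within (F y) i x else within H j x

  decodeTrace-complete : ∀ lo hi δ β y (D : Fin (suc s) → ℚ) →
    (∀ x → D x ≡ δ + H x - (β ℚ.⊓ M y x + β ℚ.⊓ M y x)) →
    ∃ λ code → ∀ x → does (inRange? lo hi (D x)) ≡ decodeTrace code x
  decodeTrace-complete lo hi δ β y D D≡ = (y , c , i , j) , λ x →
    trans (if-does (M y x ℚ.≤? β) (below x) (above x))
          (cong (λ b → if b then within (F y) i x else within H j x) (sym (proj₂ cut x)))
    where
    open ≡-Reasoning
    open +-*-Solver
    ε = δ - (β + β)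
    cut = lowerCut-complete (M y) β
    c = proj₁ cut
    interval₁ = within-complete (F y) (lo - δ) (hi - δ)
    i = proj₁ interval₁
    interval₂ = within-complete H (lo - ε) (hi - ε)
    j = proj₁ interval₂

    below : ∀ x → M y x ≤ℚ β → does (inRange? lo hi (D x)) ≡ within (F y) i x
    below x M≤β = begin
      does (inRange? lo hi (D x))               ≡⟨ inRange?-+ lo hi (D x) (F y x) δ (trans (D≡ x) D≡F+δ) ⟩
      does (inRange? (lo - δ) (hi - δ) (F y x)) ≡⟨ proj₂ interval₁ x ⟨
      within (F y) i x                          ∎
      where
      D≡F+δ : δ + H x - (β ℚ.⊓ M y x + β ℚ.⊓ M y x) ≡ F y x + δ
      D≡F+δ = trans (cong (λ μ → δ + H x - (μ + μ)) (ℚ.p≥q⇒p⊓q≡q M≤β))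
                    (solve 3 (λ δ h μ → δ :+ h :- (μ :+ μ) := h :- (μ :+ μ) :+ δ) refl δ (H x) (M y x))

    above : ∀ x → ¬ M y x ≤ℚ β → does (inRange? lo hi (D x)) ≡ within H j x
    above x M≰β = begin
      does (inRange? lo hi (D x))               ≡⟨ inRange?-+ lo hi (D x) (H x) ε (trans (D≡ x) D≡H+ε) ⟩
      does (inRange? (lo - ε) (hi - ε) (H x))   ≡⟨ proj₂ interval₂ x ⟨
      within H j x                              ∎
      where
      D≡H+ε : δ + H x - (β ℚ.⊓ M y x + β ℚ.⊓ M y x) ≡ H x + ε
      D≡H+ε = trans (cong (λ μ → δ + H x - (μ + μ)) (ℚ.p≤q⇒p⊓q≡p (ℚ.<⇒≤ (ℚ.≰⇒> M≰β))))
                    (solve 3 (λ δ h μ → δ :+ h :- (μ :+ μ) := h :+ (δ :- (μ :+ μ))) refl δ (H x) β)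

IsPCG⇒TracesAmong : ∀ {n s} {G : Graph n} → IsPCG G → (σ : Fin (suc s) → Fin n) → TracesAmong (PCGCode s) G σ
IsPCG⇒TracesAmong {n} {s} {G} (_ , T , dmin , dmax , ζ , _ , _ , _ , _ , _ , adj⇔) σ = decodeTrace H M , coded
  where
  open RootedTree T (ζ (σ Fin.zero))

  H : Fin (suc s) → ℚ
  H x = depth (ζ (σ x))

  M : Fin (suc s) → Fin (suc s) → ℚ
  M y x = meet (ζ (σ y)) (ζ (σ x))

  coded : ∀ v → Outside σ v → ∃ λ code → ∀ x → adj G v (σ x) ≡ decodeTrace H M code x
  coded v v∉ = code , λ x → trans (≡-does (adj⇔ v (σ x) (v∉ x)) (inRange? dmin dmax (D x))) (proj₂ coding x)
    where
    y = proj₁ (meet-pivot (ζ ∘ σ) (ζ v))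
    pivot = proj₂ (meet-pivot (ζ ∘ σ) (ζ v))
    D : Fin (suc s) → ℚ
    D x = dist T (ζ v) (ζ (σ x))
    D≡ : ∀ x → D x ≡ depth (ζ v) + H x - (meet (ζ v) (ζ (σ y)) ℚ.⊓ M y x + meet (ζ v) (ζ (σ y)) ℚ.⊓ M y x)
    D≡ x = trans (dist-via-meet (ζ v) (ζ (σ x))) (cong (λ μ → depth (ζ v) + H x - (μ + μ)) (pivot x))
    coding = decodeTrace-complete H M dmin dmax (depth (ζ v)) (meet (ζ v) (ζ (σ y))) y D D≡
    code = proj₁ coding

filterᵇ-cong : ∀ {A : Set} {p q : A → Bool} → p ≗ q → ∀ xs → filterᵇ p xs ≡ filterᵇ q xs
filterᵇ-cong         p≗q []       = refl
filterᵇ-cong {q = q} p≗q (x ∷ xs) rewrite p≗q x with q x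
... | true  = cong (x ∷_) (filterᵇ-cong p≗q xs)
... | false = filterᵇ-cong p≗q xs

IsThresholdPCG⇒TracesAmong : ∀ {k t n N C} {H : Graph n} {σ : Fin N → Fin n} → IsThresholdPCG k t H →
                             (∀ {G} → IsPCG G → TracesAmong (Fin C) G σ) → TracesAmong (Fin (C ^ k)) H σ
IsThresholdPCG⇒TracesAmong {k} {t} {N = N} {C} {H} {σ} (Gs , pcg , adj⇔) traces = decode , coded
  where
  decodeᵢ : Fin k → Fin C → Fin N → Bool
  decodeᵢ i = proj₁ (traces {Gs i} (pcg i))

  decode : Fin (C ^ k) → Fin N → Bool
  decode c x = does (t ℕ.≤? length (filterᵇ (λ i → decodeᵢ i (finToFun c i) x) (allFin k)))

  coded : ∀ v → Outside σ v → ∃ λ c → ∀ x → adj H v (σ x) ≡ decode c x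
  coded v v∉ = funToFin code , λ x →
    trans (≡-does (adj⇔ v (σ x) (v∉ x)) (t ℕ.≤? _))
          (cong (λ m → does (t ℕ.≤? m)) (cong length (filterᵇ-cong (adjᵢ≡ x) (allFin k))))
    where
    code : Fin k → Fin C
    code i = proj₁ (proj₂ (traces {Gs i} (pcg i)) v v∉)
    adjᵢ≡ : ∀ x i → adj (Gs i) v (σ x) ≡ decodeᵢ i (finToFun (funToFin code) i) x
    adjᵢ≡ x i = trans (proj₂ (proj₂ (traces {Gs i} (pcg i)) v v∉) x)
                      (cong (λ c → decodeᵢ i c x) (sym (finToFun-funToFin code i)))

-- Graphs shattering a vertex set

funToFin-cong : ∀ {m n} {f g : Fin m → Fin n} → f ≗ g → funToFin f ≡ funToFin g
funToFin-cong {zero}  _   = refl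
funToFin-cong {suc m} f≗g = cong₂ Fin.combine (f≗g Fin.zero) (funToFin-cong (f≗g ∘ Fin.suc))

module _ {N : ℕ} where

  subset : Fin (2 ^ N) → Fin N → Bool
  subset i x = Inverse.to 2↔Bool (finToFun {2} {N} i x)

  subset-of : (Fin N → Bool) → Fin (2 ^ N)
  subset-of S = funToFin (Inverse.from 2↔Bool ∘ S)

  subset-subset-of : ∀ S → subset (subset-of S) ≗ S
  subset-subset-of S x = trans (cong (Inverse.to 2↔Bool) (finToFun-funToFin (Inverse.from 2↔Bool ∘ S) x))
                               (Inverse.strictlyInverseˡ 2↔Bool (S x))

  subset-injective : ∀ {i j} → subset i ≗ subset j → i ≡ j
  subset-injective {i} {j} i≗j = begin
    i                                         ≡⟨ funToFin-finToFin {N} {2} i ⟨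
    funToFin (finToFun {2} {N} i)             ≡⟨ funToFin-cong (Inverse.strictlyInverseʳ 2↔Bool ∘ finToFun {2} {N} i) ⟨
    funToFin (Inverse.from 2↔Bool ∘ subset i) ≡⟨ funToFin-cong (cong (Inverse.from 2↔Bool) ∘ i≗j) ⟩
    funToFin (Inverse.from 2↔Bool ∘ subset j) ≡⟨ funToFin-cong (Inverse.strictlyInverseʳ 2↔Bool ∘ finToFun {2} {N} j) ⟩
    funToFin (finToFun {2} {N} j)             ≡⟨ funToFin-finToFin {N} {2} j ⟩
    j                                         ∎
    where open ≡-Reasoning

Shatters : ∀ {n N} → Graph n → (Fin N → Fin n) → Set
Shatters {N = N} G σ = ∀ (S : Fin N → Bool) → ∃ λ v → Outside σ v × ∀ x → adj G v (σ x) ≡ S x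

Shatters⇒2^≤ : ∀ {n N C} {G : Graph n} {σ : Fin N → Fin n} → Shatters G σ → TracesAmong (Fin C) G σ → 2 ^ N ≤ C
Shatters⇒2^≤ {G = G} {σ} shatters (decode , coded) = ℕ.≮⇒≥ λ C<2^N →
  let i , j , i<j , same-code = pigeonhole C<2^N code
      same-subset = λ x → trans (subset≡ i x) (trans (cong (λ c → decode c x) same-code) (sym (subset≡ j x)))
  in ℕ.<-irrefl (cong Fin.toℕ (subset-injective {i = i} {j} same-subset)) i<j
  where
  realiser : ∀ i → ∃ λ v → Outside σ v × ∀ x → adj G v (σ x) ≡ subset i x
  realiser i = shatters (subset i)
  code : Fin _ → Fin _
  code i = proj₁ (coded (proj₁ (realiser i)) (proj₁ (proj₂ (realiser i))))
  subset≡ : ∀ i x → subset i x ≡ decode (code i) x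
  subset≡ i x = trans (sym (proj₂ (proj₂ (realiser i)) x))
                      (proj₂ (coded (proj₁ (realiser i)) (proj₁ (proj₂ (realiser i)))) x)

complement-adj : ∀ {n} (G : Graph n) {u v} → u ≢ v → adj (complement G) u v ≡ not (adj G u v)
complement-adj G {u} {v} u≢v with u Fin.≟ v
... | yes u≡v = ⊥-elim (u≢v u≡v)
... | no  _   = refl

complement-shatters : ∀ {n N} (G : Graph n) {σ : Fin N → Fin n} → Shatters G σ → Shatters (complement G) σ
complement-shatters G shatters S with v , v∉ , v≡ ← shatters (not ∘ S) =
  v , v∉ , λ x → trans (complement-adj G (v∉ x)) (trans (cong not (v≡ x)) (not-involutive (S x)))

module _ {N M} (R : Fin N → Fin M → Bool) where

  private
    across : Fin N ⊎ Fin M → Fin N ⊎ Fin M → Bool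
    across (inj₁ x) (inj₂ j) = R x j
    across (inj₂ j) (inj₁ x) = R x j
    across _        _        = false

    across-sym : ∀ p q → across p q ≡ across q p
    across-sym (inj₁ _) (inj₁ _) = refl
    across-sym (inj₁ _) (inj₂ _) = refl
    across-sym (inj₂ _) (inj₁ _) = refl
    across-sym (inj₂ _) (inj₂ _) = refl

    across-irrefl : ∀ p → across p p ≡ false
    across-irrefl (inj₁ _) = refl
    across-irrefl (inj₂ _) = refl

  bipartite : Graph (N ℕ.+ M)
  bipartite = record
    { adj    = λ u v → across (Fin.splitAt N u) (Fin.splitAt N v)
    ; adjSym = λ u v → across-sym (Fin.splitAt N u) (Fin.splitAt N v)
    ; irrefl = λ u → across-irrefl (Fin.splitAt N u)
    }

  bipartite-adj : ∀ j x → adj bipartite (N Fin.↑ʳ j) (x Fin.↑ˡ M) ≡ R x j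
  bipartite-adj j x rewrite splitAt-↑ʳ N M j | splitAt-↑ˡ N x M = refl

restrict : ∀ {m n} → Fin n → Maybe (Fin m)
restrict {m} u with Fin.toℕ u ℕ.<? m
... | yes u<m = just (Fin.fromℕ< u<m)
... | no  _   = nothing

restrict-inject≤ : ∀ {m n} (u : Fin m) (m≤n : m ≤ n) → restrict (Fin.inject≤ u m≤n) ≡ just u
restrict-inject≤ {m} u m≤n with Fin.toℕ (Fin.inject≤ u m≤n) ℕ.<? m
... | yes u<m = cong just (toℕ-injective (trans (toℕ-fromℕ< u<m) (toℕ-inject≤ u m≤n)))
... | no  u≮m = ⊥-elim (u≮m (subst (_< m) (sym (toℕ-inject≤ u m≤n)) (toℕ<n u)))

module _ {m n} (m≤n : m ≤ n) (G : Graph m) where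

  private
    adjᴹ : Maybe (Fin m) → Maybe (Fin m) → Bool
    adjᴹ (just u) (just v) = adj G u v
    adjᴹ _        _        = false

    adjᴹ-sym : ∀ p q → adjᴹ p q ≡ adjᴹ q p
    adjᴹ-sym (just u) (just v) = adjSym G u v
    adjᴹ-sym (just _) nothing  = refl
    adjᴹ-sym nothing  (just _) = refl
    adjᴹ-sym nothing  nothing  = refl

    adjᴹ-irrefl : ∀ p → adjᴹ p p ≡ false
    adjᴹ-irrefl (just u) = irrefl G u
    adjᴹ-irrefl nothing  = refl

  pad : Graph n
  pad = record
    { adj    = λ u v → adjᴹ (restrict u) (restrict v)
    ; adjSym = λ u v → adjᴹ-sym (restrict u) (restrict v)
    ; irrefl = λ u → adjᴹ-irrefl (restrict u)
    }

  pad-adj : ∀ u v → adj pad (Fin.inject≤ u m≤n) (Fin.inject≤ v m≤n) ≡ adj G u v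
  pad-adj u v rewrite restrict-inject≤ u m≤n | restrict-inject≤ v m≤n = refl

module _ (N : ℕ) {n} (size : N ℕ.+ 2 ^ N ≤ n) where

  private
    membership : Fin N → Fin (2 ^ N) → Bool
    membership x i = subset i x

  shatteringGraph : Graph n
  shatteringGraph = pad size (bipartite membership)

  shattered : Fin N → Fin n
  shattered x = Fin.inject≤ (x Fin.↑ˡ 2 ^ N) size

  shatteringGraph-shatters : Shatters shatteringGraph shattered
  shatteringGraph-shatters S = v , outside , λ x →
    trans (pad-adj size _ (N Fin.↑ʳ subset-of S) (x Fin.↑ˡ 2 ^ N))
          (trans (bipartite-adj membership (subset-of S) x) (subset-subset-of S x))
    where
    v = Fin.inject≤ (N Fin.↑ʳ subset-of S) size
    outside : Outside shattered v
    outside x v≡ with () ← trans (sym (splitAt-↑ʳ N (2 ^ N) (subset-of S)))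
      (trans (cong (Fin.splitAt N) (inject≤-injective size size _ _ v≡)) (splitAt-↑ˡ N x (2 ^ N)))

pcgCodes : ℕ → ℕ
pcgCodes s = suc s ℕ.* (c ℕ.* ((c ℕ.* c) ℕ.* (c ℕ.* c)))
  where c = suc (suc s)

pcgCode↔ : ∀ s → Fin (pcgCodes s) ↔ PCGCode s
pcgCode↔ s = ↔-trans *↔× (↔-refl ×-↔ ↔-trans *↔× (↔-refl ×-↔ ↔-trans *↔× (*↔× ×-↔ *↔×)))

pcgCodes-bound : ∀ s → pcgCodes s ≤ (2 ℕ.+ s) ^ 6
pcgCodes-bound s = ℕ.≤-trans (ℕ.*-monoˡ-≤ _ (ℕ.n≤1+n (suc s)))
  (ℕ.≤-reflexive (solve 1 (λ c → c :* (c :* ((c :* c) :* (c :* c))) := c :^ 6) refl (2 ℕ.+ s)))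
  where open ℕ-Solver

n<2^n : ∀ n → n < 2 ^ n
n<2^n zero    = s≤s z≤n
n<2^n (suc n) = ℕ.+-mono-≤ (ℕ.m^n>0 2 n) (ℕ.≤-trans (n<2^n n) (ℕ.m≤m+n _ 0))

-- With s = 2 ^ (2d + 1): 2 + s ≤ 2 ^ (2d + 2), and (2d + 2) d ≤ 2 ^ (d + 1) * 2 ^ d = s.
exponential-beats-polynomial : ∀ d → ∃ λ s → (2 ℕ.+ s) ^ d < 2 ^ suc s
exponential-beats-polynomial d = 2 ^ j , ℕ.≤-<-trans base≤ (ℕ.^-monoʳ-< 2 (s≤s (s≤s z≤n)) (s≤s exponent≤))
  where
  j = suc (d ℕ.+ d)
  base≤ : (2 ℕ.+ 2 ^ j) ^ d ≤ 2 ^ (suc j ℕ.* d)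
  base≤ = ℕ.≤-trans (ℕ.^-monoˡ-≤ d (ℕ.+-mono-≤ (ℕ.*-monoʳ-≤ 2 (ℕ.m^n>0 2 (d ℕ.+ d))) (ℕ.m≤m+n _ 0)))
                    (ℕ.≤-reflexive (ℕ.^-*-assoc 2 (suc j) d))
  suc-j≤ : suc j ≤ 2 ^ suc d
  suc-j≤ = ℕ.≤-trans (ℕ.≤-reflexive (cong suc (sym (ℕ.+-suc d d))))
                     (ℕ.+-mono-≤ (n<2^n d) (ℕ.≤-trans (n<2^n d) (ℕ.m≤m+n _ 0)))
  exponent≤ : suc j ℕ.* d ≤ 2 ^ j
  exponent≤ = ℕ.≤-trans (ℕ.*-mono-≤ suc-j≤ (ℕ.<⇒≤ (n<2^n d)))
                        (ℕ.≤-reflexive (sym (ℕ.^-distribˡ-+-* 2 (suc d) d)))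

Shatters⇒¬IsThresholdPCG : ∀ {k t n s} (H : Graph n) {σ : Fin (suc s) → Fin n} →
                           (2 ℕ.+ s) ^ (6 ℕ.* k) < 2 ^ suc s → Shatters H σ → ¬ IsThresholdPCG k t H
Shatters⇒¬IsThresholdPCG {k} {t} {s = s} H {σ} small shatters threshold =
  ℕ.<-irrefl refl (ℕ.≤-<-trans (ℕ.≤-trans many few) small)
  where
  pcg-traces : ∀ {G} → IsPCG G → TracesAmong (Fin (pcgCodes s)) G σ
  pcg-traces {G} pcg = TracesAmong-↔ {G = G} {σ} (pcgCode↔ s) (IsPCG⇒TracesAmong {G = G} pcg σ)
  many : 2 ^ suc s ≤ pcgCodes s ^ k
  many = Shatters⇒2^≤ {G = H} shatters
    (IsThresholdPCG⇒TracesAmong {k} {t} {H = H} {σ} threshold λ {G} → pcg-traces {G})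
  few : pcgCodes s ^ k ≤ (2 ℕ.+ s) ^ (6 ℕ.* k)
  few = ℕ.≤-trans (ℕ.^-monoˡ-≤ k (pcgCodes-bound s)) (ℕ.≤-reflexive (ℕ.^-*-assoc (2 ℕ.+ s) 6 k))

-- The argument works for all k and t.
theorem11 : ∀ (k : ℕ) → 1 ≤ k →
    Σ ℕ λ n₀ → ∀ (n : ℕ) → n₀ ≤ n →
      Σ (Graph n) λ G → ∀ (t : ℕ) → 1 ≤ t → t ≤ k →
        ¬ IsThresholdPCG k t G × ¬ IsThresholdPCG k t (complement G)
theorem11 k _ with s , small ← exponential-beats-polynomial (6 ℕ.* k) =
  suc s ℕ.+ 2 ^ suc s , λ n size →
    let G        = shatteringGraph (suc s) size
        shatters = shatteringGraph-shatters (suc s) size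
    in G , λ t _ _ → Shatters⇒¬IsThresholdPCG G small shatters ,
                     Shatters⇒¬IsThresholdPCG (complement G) small (complement-shatters G shatters)
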